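{- Let $G=(V,E)$ be a claw-free graph with clique number $\omega(G)$. For any $v\in V$ with $\deg(v)\ge 2\omega(G)-1$, we have $Z(v)=N(v)$ and therefore \[ |N(N(v))\setminus\{v\}| \le \frac12\sum_{w\in N(v)} |N(w)\setminus(\{v\}\cup N(v))| \le \frac12\deg(v)(\omega(G)-1). \]
   Context: A graph is claw-free if it has no induced $K_{1,3}$. $N(u)$ is the open neighbourhood of a vertex $u$; for a set $S$ of vertices, $N(S)=\bigcup_{s\in S}N(s)\setminus S$. For $v\in V$, $Z(v):=\{w\in N(v) : \exists\, x,y\in N(v)\text{ with } xw,wy\in E \text{ and } xy\notin E\}$. -}

module Defs where

open import Data.Nat using (ℕ; zero; suc; _+_; _≤_)
open import Data.Bool using (Bool; true; false; if_then_else_)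
open import Data.Fin using (Fin)
open import Data.Fin.Subset using (Subset; ⋃; _─_; ⁅_⁆; _∪_; _∈_; ∣_∣)
import Data.Fin.Subset
open import Data.List using (List; map; allFin)
open import Data.Nat.ListAction using (sum)
open import Data.Vec using (tabulate; lookup)
open import Data.Product using (Σ; _×_)
open import Data.Empty renaming (⊥ to Empty)
open import Relation.Nullary using (¬_)
open import Relation.Binary.PropositionalEquality using (_≡_; _≢_)

record Graph (n : ℕ) : Set where
  field
    adj    : Fin n → Fin n → Bool
    sym    : ∀ x y → adj x y ≡ adj y x
    irrefl : ∀ x → adj x x ≡ false

module _ {n : ℕ} (G : Graph n) where
  open Graph G

  Adj : Fin n → Fin n → Set
  Adj x y = adj x y ≡ true

  N : Fin n → Subset n
  N u = tabulate (adj u)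

  deg : Fin n → ℕ
  deg u = ∣ N u ∣

  NS : Subset n → Subset n
  NS S = ⋃ (map (λ s → if lookup S s then N s else Data.Fin.Subset.⊥) (allFin n)) ─ S

  sumOver : Subset n → (Fin n → ℕ) → ℕ
  sumOver S f = sum (map (λ w → if lookup S w then f w else 0) (allFin n))

  ClawFree : Set
  ClawFree = ∀ a b c d → Adj a b → Adj a c → Adj a d →
             b ≢ c → b ≢ d → c ≢ d →
             ¬ Adj b c → ¬ Adj b d → ¬ Adj c d → Empty

  IsClique : Subset n → Set
  IsClique S = ∀ x y → x ∈ S → y ∈ S → x ≢ y → Adj x y

  IsCliqueNumber : ℕ → Set
  IsCliqueNumber ω = Σ (Subset n) (λ S → IsClique S × ∣ S ∣ ≡ ω)
                   × (∀ S → IsClique S → ∣ S ∣ ≤ ω)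

  InZ : Fin n → Fin n → Set
  InZ v w = w ∈ N v × Σ (Fin n) (λ x → Σ (Fin n) (λ y →
              x ∈ N v × y ∈ N v × Adj x w × Adj w y × x ≢ y × ¬ Adj x y))

-- If a neighbour w of v were outside Z(v), then N(v) ∩ N[w] would be a clique, and claw-freeness
-- at v would make N(v) ∖ N[w] a clique as well; adding v to each gives two cliques whose sizes
-- sum to deg v + 2, so deg v ≤ 2ω − 2.  For w ∈ N(v), claw-freeness at w makes (N(w) ∖ N[v]) ∪ {w}
-- a clique, bounding each summand by ω − 1.  A vertex u at distance two from v has a neighbour
-- w ∈ N(v) = Z(v); if x, y ∈ N(v) witness w ∈ Z(v), then u, x, y do not form a claw at w, so u has
-- a second neighbour in N(v), and double counting the edges from N(v) to the vertices outside N[v]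
-- gives the first inequality.
module Submission where

open import Defs
open import Data.Nat using (ℕ; _+_; _*_; _∸_; _≤_)
open import Data.Fin using (Fin)
open import Data.Fin.Subset using (Subset; _∈_; ∣_∣; _─_; _∪_; ⁅_⁆; _-_)
open import Data.Product using (_×_)
open import Function.Bundles using (_⇔_)

open import Data.Bool using (Bool; true; false; _∧_; if_then_else_)
import Data.Bool.Properties as Bool
open import Data.Empty using (⊥-elim)
open import Data.Fin using (zero; suc; _≟_)
open import Data.Fin.Properties using (any?)
open import Data.Fin.Subset using (_∉_; _⊂_; _∩_; ⋃)
import Data.Fin.Subset as Subset
open import Data.Fin.Subset.Properties
  using (_∈?_; ∉⊥; x∈⁅x⁆; x∈⁅y⁆⇒x≡y; p⊆p∪q; x∈p∪q⁺; x∈p∪q⁻; x∈p∩q⁺; x∈p∩q⁻; p─q⊆p;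
         x∈p∧x∉q⇒x∈p─q; x∈p∧x≢y⇒x∈p-y; x∈p⇒∣p-x∣<∣p∣; p⊂q⇒∣p∣<∣q∣)
open import Data.List using (List; map; allFin)
import Data.List as List
open import Data.List.Properties using (map-tabulate)
open import Data.Nat using (zero; suc; z≤n; s≤s; _<_)
open import Data.Nat.ListAction using (sum)
open import Data.Nat.Properties
  using (+-0-commutativeMonoid; ≤-trans; ≤-reflexive; +-mono-≤; +-suc; +-comm;
         +-identityʳ; *-suc; *-zeroʳ; *-identityʳ; m≤n+m; m+n≤o⇒m≤o∸n; ∸-monoˡ-≤; <⇒≱)
open import Data.Product using (∃; _,_; proj₁; proj₂)
open import Data.Sum using (_⊎_; inj₁; inj₂; [_,_]′)
open import Data.Vec using (_∷_; []; here; there; lookup; tabulate)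
open import Data.Vec.Properties using (lookup∘tabulate; lookup-zipWith; []=⇒lookup; lookup⇒[]=)
open import Function using (_∘_; mk⇔)
open import Relation.Nullary using (¬_; Dec; yes; no; _×-dec_; ¬?)
open import Relation.Nullary.Decidable using (decidable-stable)
open import Relation.Binary.PropositionalEquality
  using (_≡_; _≢_; refl; sym; trans; cong; subst; ≢-sym; module ≡-Reasoning)
open import Algebra.Properties.CommutativeMonoid.Sum +-0-commutativeMonoid
  using (sum-syntax; sum-cong-≗; sum-replicate-zero; ∑-comm)

∑∈ : ∀ {n} → Subset n → (Fin n → ℕ) → ℕ
∑∈ {n} p f = ∑[ i < n ] (if lookup p i then f i else 0)

syntax ∑∈ p (λ i → x) = ∑[ i ∈ p ] x

sum-tabulate : ∀ {n} (f : Fin n → ℕ) → sum (List.tabulate f) ≡ ∑[ i < n ] f i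
sum-tabulate {zero}  f = refl
sum-tabulate {suc n} f = cong (f zero +_) (sum-tabulate (f ∘ suc))

sum-map-allFin : ∀ {n} (f : Fin n → ℕ) → sum (map f (allFin n)) ≡ ∑[ i < n ] f i
sum-map-allFin f = trans (cong sum (map-tabulate (λ i → i) f)) (sum-tabulate f)

∑∈-const : ∀ {n} (p : Subset n) (k : ℕ) → ∑[ i ∈ p ] k ≡ ∣ p ∣ * k
∑∈-const []          k = refl
∑∈-const (true ∷ p)  k = cong (k +_) (∑∈-const p k)
∑∈-const (false ∷ p) k = ∑∈-const p k

∣p∣≡∑∈1 : ∀ {n} (p : Subset n) → ∣ p ∣ ≡ ∑[ i ∈ p ] 1
∣p∣≡∑∈1 p = sym (trans (∑∈-const p 1) (*-identityʳ ∣ p ∣))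

∑∈≤∣p∣* : ∀ {n} (p : Subset n) {f : Fin n → ℕ} {k : ℕ} →
          (∀ {i} → i ∈ p → f i ≤ k) → ∑[ i ∈ p ] f i ≤ ∣ p ∣ * k
∑∈≤∣p∣* []          f≤k = z≤n
∑∈≤∣p∣* (true ∷ p)  f≤k = +-mono-≤ (f≤k here) (∑∈≤∣p∣* p (f≤k ∘ there))
∑∈≤∣p∣* (false ∷ p) f≤k = ∑∈≤∣p∣* p (f≤k ∘ there)

*∣p∣≤∑ : ∀ {n} (p : Subset n) {f : Fin n → ℕ} {k : ℕ} →
         (∀ {i} → i ∈ p → k ≤ f i) → k * ∣ p ∣ ≤ ∑[ i < n ] f i
*∣p∣≤∑ [] {k = k} k≤f = ≤-reflexive (*-zeroʳ k)
*∣p∣≤∑ (true ∷ p) {f} {k} k≤f =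
  subst (_≤ f zero + ∑[ i < _ ] f (suc i)) (sym (*-suc k ∣ p ∣))
    (+-mono-≤ (k≤f here) (*∣p∣≤∑ p (k≤f ∘ there)))
*∣p∣≤∑ (false ∷ p) {f} k≤f = ≤-trans (*∣p∣≤∑ p (k≤f ∘ there)) (m≤n+m _ (f zero))

+-<-2*∸1 : ∀ {a b ω} → a < ω → b < ω → a + b < 2 * ω ∸ 1
+-<-2*∸1 {a} {b} {ω} a<ω b<ω = m+n≤o⇒m≤o∸n (suc (a + b))
  (subst (_≤ 2 * ω) (cong suc (trans (+-suc a b) (+-comm 1 (a + b))))
    (+-mono-≤ a<ω (≤-trans b<ω (≤-reflexive (sym (+-identityʳ ω))))))

∈-tabulate⁺ : ∀ {n} {f : Fin n → Bool} {i : Fin n} → f i ≡ true → i ∈ tabulate f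
∈-tabulate⁺ {f = f} {i} fi = lookup⇒[]= i (tabulate f) (trans (lookup∘tabulate f i) fi)

∈-tabulate⁻ : ∀ {n} {f : Fin n → Bool} {i : Fin n} → i ∈ tabulate f → f i ≡ true
∈-tabulate⁻ {f = f} {i} i∈ = trans (sym (lookup∘tabulate f i)) ([]=⇒lookup i∈)

x∈p─q⇒x∉q : ∀ {n} {x : Fin n} (p q : Subset n) → x ∈ p ─ q → x ∉ q
x∈p─q⇒x∉q (_ ∷ p) (_ ∷ q) ()        here
x∈p─q⇒x∉q (_ ∷ p) (_ ∷ q) (there x∈) (there x∈q) = x∈p─q⇒x∉q p q x∈ x∈q

∈⋃-map⁻ : ∀ {n} {A : Set} (F : A → Subset n) (xs : List A) {x : Fin n} →
          x ∈ ⋃ (map F xs) → ∃ λ a → x ∈ F a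
∈⋃-map⁻ F List.[]       x∈ = ⊥-elim (∉⊥ x∈)
∈⋃-map⁻ F (a List.∷ xs) x∈ = [ (a ,_) , ∈⋃-map⁻ F xs ]′ (x∈p∪q⁻ (F a) _ x∈)

p⊂p∪⁅x⁆ : ∀ {n} {p : Subset n} {x : Fin n} → x ∉ p → p ⊂ p ∪ ⁅ x ⁆
p⊂p∪⁅x⁆ {x = x} x∉p = p⊆p∪q ⁅ x ⁆ , x , x∈p∪q⁺ (inj₂ (x∈⁅x⁆ x)) , x∉p

2≤∣p∣ : ∀ {n} {p : Subset n} {x y : Fin n} → x ∈ p → y ∈ p → x ≢ y → 2 ≤ ∣ p ∣
2≤∣p∣ x∈p y∈p x≢y =
  ≤-trans (s≤s (≤-trans (s≤s z≤n) (x∈p⇒∣p-x∣<∣p∣ (x∈p∧x≢y⇒x∈p-y y∈p (≢-sym x≢y)))))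
          (x∈p⇒∣p-x∣<∣p∣ x∈p)

∣p∩q∣+∣p─q∣≡∣p∣ : ∀ {n} (p q : Subset n) → ∣ p ∩ q ∣ + ∣ p ─ q ∣ ≡ ∣ p ∣
∣p∩q∣+∣p─q∣≡∣p∣ []          []          = refl
∣p∩q∣+∣p─q∣≡∣p∣ (true ∷ p)  (true ∷ q)  = cong suc (∣p∩q∣+∣p─q∣≡∣p∣ p q)
∣p∩q∣+∣p─q∣≡∣p∣ (true ∷ p)  (false ∷ q) =
  trans (+-suc ∣ p ∩ q ∣ ∣ p ─ q ∣) (cong suc (∣p∩q∣+∣p─q∣≡∣p∣ p q))
∣p∩q∣+∣p─q∣≡∣p∣ (false ∷ p) (true ∷ q)  = ∣p∩q∣+∣p─q∣≡∣p∣ p q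
∣p∩q∣+∣p─q∣≡∣p∣ (false ∷ p) (false ∷ q) = ∣p∩q∣+∣p─q∣≡∣p∣ p q

_ᵀ : ∀ {n m} → (Fin n → Subset m) → Fin m → Subset n
(X ᵀ) u = tabulate (λ w → lookup (X w) u)

∈ᵀ⁺ : ∀ {n m} {X : Fin n → Subset m} {w : Fin n} {u : Fin m} → u ∈ X w → w ∈ (X ᵀ) u
∈ᵀ⁺ u∈Xw = ∈-tabulate⁺ ([]=⇒lookup u∈Xw)

∑-∧-card : ∀ {m} (b : Bool) (q : Subset m) →
           ∑[ u < m ] (if b ∧ lookup q u then 1 else 0) ≡ (if b then ∣ q ∣ else 0)
∑-∧-card true  q = sym (∣p∣≡∑∈1 q)
∑-∧-card {m} false q = sum-replicate-zero m

∑-card-ᵀ : ∀ {n m} (S : Subset n) (X : Fin n → Subset m) →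
           ∑[ u < m ] ∣ S ∩ (X ᵀ) u ∣ ≡ ∑[ w ∈ S ] ∣ X w ∣
∑-card-ᵀ {n} {m} S X = begin
  ∑[ u < m ] ∣ S ∩ (X ᵀ) u ∣
    ≡⟨ sum-cong-≗ (λ u → trans (∣p∣≡∑∈1 (S ∩ (X ᵀ) u)) (sum-cong-≗ (incidence u))) ⟩
  ∑[ u < m ] ∑[ w < n ] (if lookup S w ∧ lookup (X w) u then 1 else 0)
    ≡⟨ ∑-comm (λ u w → if lookup S w ∧ lookup (X w) u then 1 else 0) ⟩
  ∑[ w < n ] ∑[ u < m ] (if lookup S w ∧ lookup (X w) u then 1 else 0)
    ≡⟨ sum-cong-≗ (λ w → ∑-∧-card (lookup S w) (X w)) ⟩
  ∑[ w ∈ S ] ∣ X w ∣ ∎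
  where
  open ≡-Reasoning
  incidence : ∀ u w → (if lookup (S ∩ (X ᵀ) u) w then 1 else 0)
                    ≡ (if lookup S w ∧ lookup (X w) u then 1 else 0)
  incidence u w = cong (if_then 1 else 0)
    (trans (lookup-zipWith _∧_ w S ((X ᵀ) u)) (cong (lookup S w ∧_) (lookup∘tabulate _ w)))

double-counting : ∀ {n m} (S : Subset n) (X : Fin n → Subset m) (D : Subset m) {k : ℕ} →
                  (∀ {u} → u ∈ D → k ≤ ∣ S ∩ (X ᵀ) u ∣) → k * ∣ D ∣ ≤ ∑[ w ∈ S ] ∣ X w ∣
double-counting S X D k≤ = ≤-trans (*∣p∣≤∑ D k≤) (≤-reflexive (∑-card-ᵀ S X))

module _ {n : ℕ} (G : Graph n) where
  open Graph G using (adj; irrefl)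

  sumOver≡∑∈ : (p : Subset n) (f : Fin n → ℕ) → sumOver G p f ≡ ∑[ i ∈ p ] f i
  sumOver≡∑∈ p f = sum-map-allFin (λ i → if lookup p i then f i else 0)

  Adj-sym : ∀ {x y} → Adj G x y → Adj G y x
  Adj-sym {x} {y} xy = trans (Graph.sym G y x) xy

  Adj⇒≢ : ∀ {x y} → Adj G x y → x ≢ y
  Adj⇒≢ {x} xx refl with trans (sym (irrefl x)) xx
  ... | ()

  Adj? : ∀ x y → Dec (Adj G x y)
  Adj? x y = adj x y Bool.≟ true

  ∈N⁺ : ∀ {u x} → Adj G u x → x ∈ N G u
  ∈N⁺ = ∈-tabulate⁺

  ∈N⁻ : ∀ {u x} → x ∈ N G u → Adj G u x
  ∈N⁻ = ∈-tabulate⁻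

  N[_] : Fin n → Subset n
  N[ v ] = ⁅ v ⁆ ∪ N G v

  ∈N[]⁻ : ∀ {w x} → x ∈ N[ w ] → x ≡ w ⊎ Adj G w x
  ∈N[]⁻ {w} x∈ = [ inj₁ ∘ x∈⁅y⁆⇒x≡y w , inj₂ ∘ ∈N⁻ ]′ (x∈p∪q⁻ ⁅ w ⁆ (N G w) x∈)

  IsCliqueBound : ℕ → Set
  IsCliqueBound ω = ∀ S → IsClique G S → ∣ S ∣ ≤ ω

  IsClique-∪⁅⁆ : ∀ {p c} → (∀ {x} → x ∈ p → Adj G c x) → IsClique G p → IsClique G (p ∪ ⁅ c ⁆)
  IsClique-∪⁅⁆ {p} {c} c~p p-clique x y x∈ y∈ x≢y
    with x∈p∪q⁻ p ⁅ c ⁆ x∈ | x∈p∪q⁻ p ⁅ c ⁆ y∈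
  ... | inj₁ x∈p | inj₁ y∈p = p-clique x y x∈p y∈p x≢y
  ... | inj₁ x∈p | inj₂ y∈c rewrite x∈⁅y⁆⇒x≡y c y∈c = Adj-sym (c~p x∈p)
  ... | inj₂ x∈c | inj₁ y∈p rewrite x∈⁅y⁆⇒x≡y c x∈c = c~p y∈p
  ... | inj₂ x∈c | inj₂ y∈c = ⊥-elim (x≢y (trans (x∈⁅y⁆⇒x≡y c x∈c) (sym (x∈⁅y⁆⇒x≡y c y∈c))))

  ∣p∣<ω : ∀ {ω p c} → IsCliqueBound ω → c ∉ p → IsClique G (p ∪ ⁅ c ⁆) → ∣ p ∣ < ω
  ∣p∣<ω {p = p} {c} ω-bound c∉p clique =
    ≤-trans (p⊂q⇒∣p∣<∣q∣ (p⊂p∪⁅x⁆ c∉p)) (ω-bound (p ∪ ⁅ c ⁆) clique)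

  InZ? : ∀ v w → Dec (InZ G v w)
  InZ? v w = (w ∈? N G v) ×-dec any? λ x → any? λ y →
    (x ∈? N G v) ×-dec (y ∈? N G v) ×-dec Adj? x w ×-dec Adj? w y ×-dec ¬? (x ≟ y) ×-dec ¬? (Adj? x y)

  ∈NS⁻ : ∀ {S u} → u ∈ NS G S → u ∉ S × ∃ λ s → s ∈ S × Adj G s u
  ∈NS⁻ {S} {u} u∈ = x∈p─q⇒x∉q _ S u∈ , restricted (∈⋃-map⁻ _ (allFin n) (p─q⊆p _ S u∈))
    where
    restricted : (∃ λ s → u ∈ (if lookup S s then N G s else Subset.⊥)) → ∃ λ s → s ∈ S × Adj G s u
    restricted (s , u∈) with lookup S s in S[s]
    ... | true  = s , lookup⇒[]= s S S[s] , ∈N⁻ u∈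
    ... | false = ⊥-elim (∉⊥ u∈)

  common-neighbours-clique : ∀ {v w} → w ∈ N G v → ¬ InZ G v w → IsClique G (N G v ∩ N[ w ])
  common-neighbours-clique {v} {w} w∈N ¬Z x y x∈ y∈ x≢y
    with x∈p∩q⁻ (N G v) N[ w ] x∈ | x∈p∩q⁻ (N G v) N[ w ] y∈
  ... | x∈N , x∈N[w] | y∈N , y∈N[w] with ∈N[]⁻ x∈N[w] | ∈N[]⁻ y∈N[w]
  ... | inj₁ refl | inj₁ refl = ⊥-elim (x≢y refl)
  ... | inj₁ refl | inj₂ wy   = wy
  ... | inj₂ wx   | inj₁ refl = Adj-sym wx
  ... | inj₂ wx   | inj₂ wy with Adj? x y
  ...   | yes xy = xy
  ...   | no ¬xy = ⊥-elim (¬Z (w∈N , x , y , x∈N , y∈N , Adj-sym wx , wy , x≢y , ¬xy))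

  ∣common-neighbours∣<ω : ∀ {ω v w} → IsCliqueBound ω → w ∈ N G v → ¬ InZ G v w →
                         ∣ N G v ∩ N[ w ] ∣ < ω
  ∣common-neighbours∣<ω {v = v} {w} ω-bound w∈N ¬Z = ∣p∣<ω ω-bound
    (λ v∈ → Adj⇒≢ (∈N⁻ (proj₁ (x∈p∩q⁻ (N G v) N[ w ] v∈))) refl)
    (IsClique-∪⁅⁆ (∈N⁻ ∘ proj₁ ∘ x∈p∩q⁻ (N G v) N[ w ]) (common-neighbours-clique w∈N ¬Z))

  module _ (claw-free : ClawFree G) where

    private-neighbours-clique : ∀ {c b} → Adj G c b → IsClique G (N G c ─ N[ b ])
    private-neighbours-clique {c} {b} cb x y x∈ y∈ x≢y with Adj? x y
    ... | yes xy = xy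
    ... | no ¬xy = ⊥-elim (claw-free c b x y cb (∈N⁻ (p─q⊆p _ _ x∈)) (∈N⁻ (p─q⊆p _ _ y∈))
                     (≢-sym (proj₁ (∉N[] x∈))) (≢-sym (proj₁ (∉N[] y∈))) x≢y
                     (proj₂ (∉N[] x∈)) (proj₂ (∉N[] y∈)) ¬xy)
      where
      ∉N[] : ∀ {z} → z ∈ N G c ─ N[ b ] → z ≢ b × ¬ Adj G b z
      ∉N[] z∈ = let z∉ = x∈p─q⇒x∉q (N G c) N[ b ] z∈ in
        (λ { refl → z∉ (x∈p∪q⁺ (inj₁ (x∈⁅x⁆ b))) }) , z∉ ∘ x∈p∪q⁺ ∘ inj₂ ∘ ∈N⁺

    ∣private-neighbours∣<ω : ∀ {ω c b} → IsCliqueBound ω → Adj G c b → ∣ N G c ─ N[ b ] ∣ < ω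
    ∣private-neighbours∣<ω {c = c} {b} ω-bound cb = ∣p∣<ω ω-bound
      (λ c∈ → Adj⇒≢ (∈N⁻ (p─q⊆p (N G c) N[ b ] c∈)) refl)
      (IsClique-∪⁅⁆ (∈N⁻ ∘ p─q⊆p (N G c) N[ b ]) (private-neighbours-clique cb))

    deg<2ω∸1 : ∀ {ω v w} → IsCliqueBound ω → w ∈ N G v → ¬ InZ G v w → deg G v < 2 * ω ∸ 1
    deg<2ω∸1 {ω} {v} {w} ω-bound w∈N ¬Z =
      subst (_< 2 * ω ∸ 1) (∣p∩q∣+∣p─q∣≡∣p∣ (N G v) N[ w ])
        (+-<-2*∸1 (∣common-neighbours∣<ω ω-bound w∈N ¬Z)
                  (∣private-neighbours∣<ω ω-bound (∈N⁻ w∈N)))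

    N⊆Z : ∀ {ω v w} → IsCliqueBound ω → 2 * ω ∸ 1 ≤ deg G v → w ∈ N G v → InZ G v w
    N⊆Z {v = v} {w} ω-bound large w∈N =
      decidable-stable (InZ? v w) (λ ¬Z → <⇒≱ (deg<2ω∸1 ω-bound w∈N ¬Z) large)

    second-neighbour : ∀ {v u w} → (∀ {w} → w ∈ N G v → InZ G v w) → u ∉ N G v →
                       w ∈ N G v → Adj G w u → ∃ λ w′ → w′ ∈ N G v × Adj G w′ u × w ≢ w′
    second-neighbour {u = u} {w} N⊆Z′ u∉N w∈N wu with N⊆Z′ w∈N
    ... | _ , x , y , x∈N , y∈N , xw , wy , x≢y , ¬xy with Adj? u x | Adj? u y
    ...   | yes ux | _      = x , x∈N , Adj-sym ux , ≢-sym (Adj⇒≢ xw)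
    ...   | no _   | yes uy = y , y∈N , Adj-sym uy , Adj⇒≢ wy
    ...   | no ¬ux | no ¬uy = ⊥-elim (claw-free w u x y wu (Adj-sym xw) wy
                                (λ { refl → u∉N x∈N }) (λ { refl → u∉N y∈N }) x≢y ¬ux ¬uy ¬xy)

    distance-two-incidence : ∀ {v u} → (∀ {w} → w ∈ N G v → InZ G v w) → u ∈ NS G (N G v) - v →
                             2 ≤ ∣ N G v ∩ ((λ w → N G w ─ N[ v ]) ᵀ) u ∣
    distance-two-incidence {v} {u} N⊆Z′ u∈D
      with ∈NS⁻ (p─q⊆p _ ⁅ v ⁆ u∈D)
    ... | u∉N , w , w∈N , wu with second-neighbour N⊆Z′ u∉N w∈N wu
    ...   | w′ , w′∈N , w′u , w≢w′ = 2≤∣p∣ (incident w∈N wu) (incident w′∈N w′u) w≢w′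
      where
      u∉N[v] : u ∉ N[ v ]
      u∉N[v] u∈ = [ x∈p─q⇒x∉q _ ⁅ v ⁆ u∈D , u∉N ]′ (x∈p∪q⁻ ⁅ v ⁆ (N G v) u∈)
      incident : ∀ {z} → z ∈ N G v → Adj G z u → z ∈ N G v ∩ ((λ w → N G w ─ N[ v ]) ᵀ) u
      incident z∈N zu =
        x∈p∩q⁺ (z∈N , ∈ᵀ⁺ {X = λ w → N G w ─ N[ v ]} (x∈p∧x∉q⇒x∈p─q (∈N⁺ zu) u∉N[v]))

corollary5p2 : ∀ {n : ℕ} (G : Graph n) (ω : ℕ) → ClawFree G → IsCliqueNumber G ω →
    ∀ (v : Fin n) → 2 * ω ∸ 1 ≤ deg G v →
      (∀ (w : Fin n) → (InZ G v w ⇔ w ∈ N G v))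
      × (2 * ∣ NS G (N G v) - v ∣ ≤ sumOver G (N G v) (λ w → ∣ N G w ─ (⁅ v ⁆ ∪ N G v) ∣))
      × (sumOver G (N G v) (λ w → ∣ N G w ─ (⁅ v ⁆ ∪ N G v) ∣) ≤ deg G v * (ω ∸ 1))
corollary5p2 G ω claw-free (_ , ω-bound) v large =
  (λ w → mk⇔ proj₁ N⊆Z′) , edges-to-distance-two , edges-leaving-N[v]
  where
  N⊆Z′ : ∀ {w} → w ∈ N G v → InZ G v w
  N⊆Z′ = N⊆Z G claw-free ω-bound large

  edges-to-distance-two : 2 * ∣ NS G (N G v) - v ∣ ≤ sumOver G (N G v) (λ w → ∣ N G w ─ N[_] G v ∣)
  edges-to-distance-two =
    subst (2 * ∣ NS G (N G v) - v ∣ ≤_) (sym (sumOver≡∑∈ G (N G v) _))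
      (double-counting (N G v) (λ w → N G w ─ N[_] G v) (NS G (N G v) - v)
        (distance-two-incidence G claw-free N⊆Z′))

  edges-leaving-N[v] : sumOver G (N G v) (λ w → ∣ N G w ─ N[_] G v ∣) ≤ deg G v * (ω ∸ 1)
  edges-leaving-N[v] =
    subst (_≤ deg G v * (ω ∸ 1)) (sym (sumOver≡∑∈ G (N G v) _))
      (∑∈≤∣p∣* (N G v) λ w∈N →
        ∸-monoˡ-≤ 1 (∣private-neighbours∣<ω G claw-free ω-bound (Adj-sym G (∈N⁻ G w∈N))))
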